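{- Let $G$ be a finite group and let $\overrightarrow{\mathrm{Endo}}(G^*)$ be the subdigraph of $\overrightarrow{\mathrm{Endo}}(G)$ induced by $G \setminus \{e\}$. The following are equivalent: (i) $\overrightarrow{\mathrm{Endo}}(G^*)$ is strongly connected (every vertex is reachable from every other vertex by a directed path); (ii) $\overrightarrow{\mathrm{Endo}}(G^*)$ is a complete digraph; (iii) $\overrightarrow{\mathrm{Endo}}(G^*)$ is Hamiltonian.
   Context: For a finite group $G$ with identity $e$, $\overrightarrow{\mathrm{Endo}}(G)$ is the directed graph with vertex set $G$ and an arc from $a$ to $b$ ($a\ne b$) iff some group endomorphism $f$ of $G$ satisfies $f(a)=b$. A complete digraph is one in which for every ordered pair of distinct vertices $(u,v)$ there is an arc from $u$ to $v$. A digraph is Hamiltonian if it contains a directed spanning cycle. -}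

module Defs where

open import Data.Nat using (ℕ)
open import Data.Fin using (Fin)
open import Data.Product using (Σ; ∃; _×_)
open import Data.Unit using (⊤)
open import Data.List using (List; []; _∷_)
open import Data.List.Relation.Unary.All using (All)
open import Data.List.Relation.Unary.Unique.Propositional using (Unique)
open import Data.List.Membership.Propositional using (_∈_)
open import Relation.Binary.PropositionalEquality using (_≡_; _≢_)
open import Relation.Binary.Construct.Closure.ReflexiveTransitive using (Star)
open import Algebra.Core using (Op₁; Op₂)
open import Algebra.Structures using (IsGroup)

record FinGroup : Set where
  field
    n       : ℕ
    _∙_     : Op₂ (Fin n)
    ε       : Fin n
    _⁻¹     : Op₁ (Fin n)
    isGroup : IsGroup _≡_ _∙_ ε _⁻¹

module _ (G : FinGroup) where
  open FinGroup G

  IsEndo : (Fin n → Fin n) → Set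
  IsEndo f = ∀ x y → f (x ∙ y) ≡ f x ∙ f y

  EndoArc : Fin n → Fin n → Set
  EndoArc a b = a ≢ b × Σ (Fin n → Fin n) (λ f → IsEndo f × f a ≡ b)

  Vertex* : Fin n → Set
  Vertex* a = a ≢ ε

  EndoArc* : Fin n → Fin n → Set
  EndoArc* a b = Vertex* a × Vertex* b × EndoArc a b

  StronglyConnected* : Set
  StronglyConnected* = ∀ u v → Vertex* u → Vertex* v → Star EndoArc* u v

  Complete* : Set
  Complete* = ∀ u v → Vertex* u → Vertex* v → u ≢ v → EndoArc* u v

Path : {A : Set} → (A → A → Set) → A → List A → Set
Path R x []       = ⊤
Path R x (y ∷ ys) = R x y × Path R y ys

lastOf : {A : Set} → A → List A → A
lastOf x []       = x
lastOf x (y ∷ ys) = lastOf y ys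

-- the list, read cyclically, is a directed cycle; lists with ≤ 1 vertex
-- count as (trivial) cycles
Cycle : {A : Set} → (A → A → Set) → List A → Set
Cycle R []           = ⊤
Cycle R (x ∷ [])     = ⊤
Cycle R (x ∷ y ∷ ys) = Path R x (y ∷ ys) × R (lastOf y ys) x

module _ (G : FinGroup) where
  open FinGroup G

  Hamiltonian* : Set
  Hamiltonian* = ∃ λ (vs : List (Fin n)) →
      Unique vs × All (Vertex* G) vs × (∀ v → Vertex* G v → v ∈ vs)
    × Cycle (EndoArc* G) vs

{-# OPTIONS --safe #-}
-- Endomorphisms compose, so "some endomorphism maps a to b" is reflexive and
-- transitive: any directed walk between distinct vertices of Endo(G*)
-- collapses to a single arc.  Hence strong connectivity and Hamiltonicity each
-- force completeness, and conversely in a complete digraph every vertex is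
-- reachable from every other and any repetition-free listing of the vertices
-- is a spanning cycle.
module Submission where

open import Defs
open import Data.Product using (Σ; _×_; _,_)
open import Data.Fin using (Fin; _≟_)
open import Data.List using (List; []; _∷_; filter; allFin)
open import Data.List.Relation.Unary.All using (All; _∷_; lookup)
open import Data.List.Relation.Unary.All.Properties using (all-filter)
open import Data.List.Relation.Unary.Any using (here; there)
open import Data.List.Relation.Unary.AllPairs using (_∷_)
open import Data.List.Relation.Unary.Unique.Propositional using (Unique)
import Data.List.Relation.Unary.Unique.Propositional.Properties as Unique
open import Data.List.Membership.Propositional using (_∈_)
open import Data.List.Membership.Propositional.Properties using (∈-filter⁺; ∈-allFin)
open import Function.Bundles using (_⇔_; mk⇔)
open import Relation.Binary.Definitions using (DecidableEquality)
open import Relation.Binary.PropositionalEquality using (_≡_; _≢_; refl; sym; trans; cong)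
open import Relation.Binary.Construct.Closure.ReflexiveTransitive
  using (Star; ε; _◅_; _◅◅_; fold)
open import Relation.Nullary using (yes; no; ¬?)
open import Relation.Unary using (Decidable)

lastOf-∈ : ∀ {A : Set} (x : A) ys → lastOf x ys ∈ x ∷ ys
lastOf-∈ x []       = here refl
lastOf-∈ x (y ∷ ys) = there (lastOf-∈ y ys)

module _ {A : Set} {R : A → A → Set} where

  Path⇒Star-from : ∀ {x v} ys → Path R x ys → v ∈ x ∷ ys → Star R x v
  Path⇒Star-from ys       p       (here refl) = ε
  Path⇒Star-from (y ∷ ys) (r , p) (there v∈) = r ◅ Path⇒Star-from ys p v∈

  Path⇒Star-toLast : ∀ {x u} ys → Path R x ys → u ∈ x ∷ ys → Star R u (lastOf x ys)
  Path⇒Star-toLast []       p       (here refl) = ε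
  Path⇒Star-toLast (y ∷ ys) (r , p) (here refl) = r ◅ Path⇒Star-toLast ys p (here refl)
  Path⇒Star-toLast (y ∷ ys) (r , p) (there u∈) = Path⇒Star-toLast ys p u∈

  Cycle⇒Star : ∀ vs → Cycle R vs → ∀ {u v} → u ∈ vs → v ∈ vs → Star R u v
  Cycle⇒Star (x ∷ [])     _       (here refl) (here refl) = ε
  Cycle⇒Star (x ∷ y ∷ ys) (p , r) u∈ v∈ =
    Path⇒Star-toLast (y ∷ ys) p u∈ ◅◅ (r ◅ Path⇒Star-from (y ∷ ys) p v∈)

  module _ {P : A → Set} (complete : ∀ {u v} → P u → P v → u ≢ v → R u v) where

    Star-complete : DecidableEquality A → ∀ {u v} → P u → P v → Star R u v
    Star-complete _≟_ {u} {v} pu pv with u ≟ v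
    ... | yes refl = ε
    ... | no u≢v   = complete pu pv u≢v ◅ ε

    Path-complete : ∀ x ys → Unique (x ∷ ys) → All P (x ∷ ys) → Path R x ys
    Path-complete x []       _                  _               = _
    Path-complete x (y ∷ ys) ((x≢y ∷ _) ∷ uniq) (px ∷ py ∷ all) =
      complete px py x≢y , Path-complete y ys uniq (py ∷ all)

    Cycle-complete : ∀ vs → Unique vs → All P vs → Cycle R vs
    Cycle-complete []           _ _ = _
    Cycle-complete (x ∷ [])     _ _ = _
    Cycle-complete (x ∷ y ∷ ys) uniq@(x∉ ∷ _) all@(px ∷ all′) =
      Path-complete x (y ∷ ys) uniq all ,
      complete (lookup all′ (lastOf-∈ y ys)) px
               (λ last≡x → lookup x∉ (lastOf-∈ y ys) (sym last≡x))

module _ (G : FinGroup) where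
  open FinGroup G renaming (ε to e)

  EndoReachable : Fin n → Fin n → Set
  EndoReachable a b = Σ (Fin n → Fin n) λ f → IsEndo G f × f a ≡ b

  endoReachable-refl : ∀ {a} → EndoReachable a a
  endoReachable-refl = (λ x → x) , (λ _ _ → refl) , refl

  endoReachable-trans : ∀ {a b c} → EndoReachable a b → EndoReachable b c → EndoReachable a c
  endoReachable-trans (f , f-endo , fa≡b) (g , g-endo , gb≡c) =
    (λ x → g (f x)) ,
    (λ x y → trans (cong g (f-endo x y)) (g-endo (f x) (f y))) ,
    trans (cong g fa≡b) gb≡c

  Star⇒EndoReachable : ∀ {a b} → Star (EndoArc* G) a b → EndoReachable a b
  Star⇒EndoReachable =
    fold EndoReachable (λ (_ , _ , _ , reach) → endoReachable-trans reach) endoReachable-refl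

  Star⇒EndoArc* : ∀ {u v} → Vertex* G u → Vertex* G v → u ≢ v →
                  Star (EndoArc* G) u v → EndoArc* G u v
  Star⇒EndoArc* u* v* u≢v walk = u* , v* , u≢v , Star⇒EndoReachable walk

  nonIdentity? : Decidable (Vertex* G)
  nonIdentity? a = ¬? (a ≟ e)

  nonIdentityElements : List (Fin n)
  nonIdentityElements = filter nonIdentity? (allFin n)

  nonIdentityElements-unique : Unique nonIdentityElements
  nonIdentityElements-unique = Unique.filter⁺ nonIdentity? (Unique.allFin⁺ n)

  nonIdentityElements-vertices : All (Vertex* G) nonIdentityElements
  nonIdentityElements-vertices = all-filter nonIdentity? (allFin n)

  StronglyConnected*⇒Complete* : StronglyConnected* G → Complete* G
  StronglyConnected*⇒Complete* sc u v u* v* u≢v = Star⇒EndoArc* u* v* u≢v (sc u v u* v*)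

  Complete*⇒StronglyConnected* : Complete* G → StronglyConnected* G
  Complete*⇒StronglyConnected* c u v = Star-complete (λ {u} {v} → c u v) _≟_

  Hamiltonian*⇒Complete* : Hamiltonian* G → Complete* G
  Hamiltonian*⇒Complete* (vs , _ , _ , spans , cycle) u v u* v* u≢v =
    Star⇒EndoArc* u* v* u≢v (Cycle⇒Star vs cycle (spans u u*) (spans v v*))

  Complete*⇒Hamiltonian* : Complete* G → Hamiltonian* G
  Complete*⇒Hamiltonian* c =
    nonIdentityElements , nonIdentityElements-unique , nonIdentityElements-vertices ,
    (λ v v* → ∈-filter⁺ nonIdentity? (∈-allFin v) v*) ,
    Cycle-complete (λ {u} {v} → c u v) nonIdentityElements
      nonIdentityElements-unique nonIdentityElements-vertices

proposition2p15 : (G : FinGroup) →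
    (StronglyConnected* G ⇔ Complete* G) × (Complete* G ⇔ Hamiltonian* G)
proposition2p15 G =
  mk⇔ (StronglyConnected*⇒Complete* G) (Complete*⇒StronglyConnected* G) ,
  mk⇔ (Complete*⇒Hamiltonian* G) (Hamiltonian*⇒Complete* G)
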